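{- $d_p(\{0,1,4,6\}) \le \frac{1}{7}$.
   Context: For $S \subseteq \mathbb{Z}$ and $a \in \mathbb{Z}$, write $S + a = \{s + a : s \in S\}$. A set $A \subseteq \mathbb{Z}$ is called $S$-packing if for all $a_1, a_2 \in A$ with $a_1 \neq a_2$, the sets $S + a_1$ and $S + a_2$ are disjoint. The upper density of $A \subseteq \mathbb{Z}$ is $\overline{d}(A) = \limsup_{n\to\infty} \frac{|A \cap [-n,n]|}{2n+1}$. The packing density of $S$ is $d_p(S) = \sup\{\overline{d}(A) : A \text{ is } S\text{ -packing}\}$. -}

module Defs where

open import Data.Product using (Σ)
open import Data.Bool using (Bool; true; false)
open import Data.Nat as ℕ using (ℕ; zero; suc)
open import Data.Integer as ℤ using (ℤ; +_; -[1+_])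
open import Data.Rational as ℚ using (ℚ; Positive)
open import Data.List using (List; []; _∷_)
open import Data.List.Membership.Propositional using (_∈_)
open import Relation.Binary.PropositionalEquality using (_≡_; _≢_)

Subset : Set
Subset = ℤ → Bool

-- A is S-packing: for a₁ ≠ a₂ in A, (S + a₁) ∩ (S + a₂) = ∅,
-- i.e. there are no s₁, s₂ ∈ S with s₁ + a₁ = s₂ + a₂.
IsPacking : List ℤ → Subset → Set
IsPacking S A = ∀ a₁ a₂ → A a₁ ≡ true → A a₂ ≡ true → a₁ ≢ a₂ →
  ∀ s₁ s₂ → s₁ ∈ S → s₂ ∈ S → s₁ ℤ.+ a₁ ≢ s₂ ℤ.+ a₂

b2n : Bool → ℕ
b2n true = 1
b2n false = 0

countFrom : Subset → ℕ → ℕ → ℕ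
countFrom A n zero = 0
countFrom A n (suc m) = b2n (A (+ m ℤ.- + n)) ℕ.+ countFrom A n m

-- |A ∩ [-n, n]|
countIn : Subset → ℕ → ℕ
countIn A n = countFrom A n (suc (n ℕ.+ n))

ratio : Subset → ℕ → ℚ
ratio A n = (+ countIn A n) ℚ./ suc (n ℕ.+ n)

-- limsup_{n→∞} ratio A n ≤ r
UpperDensity≤ : Subset → ℚ → Set
UpperDensity≤ A r = ∀ (ε : ℚ) → Positive ε →
  Σ ℕ λ N → ∀ n → N ℕ.≤ n → ratio A n ℚ.≤ r ℚ.+ ε


PackingDensity≤ : List ℤ → ℚ → Set
PackingDensity≤ S r = ∀ (A : Subset) → IsPacking S A → UpperDensity≤ A r

-- Every d with 1 ≤ d ≤ 6 is a difference of two elements of {0,1,4,6}, so two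
-- elements of a packing lie at distance at least 7.  Each window of 7 consecutive
-- integers then meets A at most once, whence 7 |A ∩ [-n, n]| ≤ (2n + 1) + 6.
module Submission where

open import Defs
open import Data.Integer using (+_)
open import Data.Rational using (_/_)
open import Data.List using (_∷_; [])

open import Data.Bool using (true; false)
open import Data.Empty using (⊥; ⊥-elim)
open import Data.Integer as ℤ using (ℤ)
import Data.Integer.Properties as ℤP
open import Data.Integer.Tactic.RingSolver using (solve-∀)
open import Data.List using (List)
open import Data.List.Membership.Propositional using (_∈_)
open import Data.List.Relation.Unary.Any using (here; there)
open import Data.Nat as ℕ using (ℕ; zero; suc; _≤_; _<_; z≤n; s≤s)
import Data.Nat.Properties as ℕP
open import Data.Nat.Induction using (<-rec)
open import Data.Product using (Σ; _×_; _,_)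
open import Relation.Nullary using (yes; no)
open import Relation.Binary.PropositionalEquality
import Data.Rational as ℚ
import Data.Rational.Properties as ℚP
import Data.Rational.Unnormalised as ℚᵘ
import Data.Rational.Unnormalised.Properties as ℚᵘP

IsDifference : List ℤ → ℤ → Set
IsDifference S x = Σ ℤ λ s₁ → Σ ℤ λ s₂ → s₁ ∈ S × s₂ ∈ S × s₁ ≡ s₂ ℤ.+ x

Separated : ℕ → Subset → Set
Separated g A = ∀ a d → 0 < d → d ≤ g → A a ≡ true → A (a ℤ.+ + d) ≡ true → ⊥

i<i+n : ∀ i n → 0 < n → i ℤ.< i ℤ.+ + n
i<i+n i n 0<n = subst (ℤ._< i ℤ.+ + n) (ℤP.+-identityʳ i) (ℤP.+-monoʳ-< i (ℤ.+<+ 0<n))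

packing⇒separated : ∀ S A g → (∀ d → 0 < d → d ≤ g → IsDifference S (+ d)) →
                    IsPacking S A → Separated g A
packing⇒separated S A g differences packing a d 0<d d≤g a∈A a+d∈A
  with differences d 0<d d≤g
... | s₁ , s₂ , s₁∈S , s₂∈S , s₁≡s₂+d =
  packing a (a ℤ.+ + d) a∈A a+d∈A (ℤP.<⇒≢ (i<i+n a d 0<d)) s₁ s₂ s₁∈S s₂∈S translates
  where
  open ≡-Reasoning
  translates : s₁ ℤ.+ a ≡ s₂ ℤ.+ (a ℤ.+ + d)
  translates = begin
    s₁ ℤ.+ a              ≡⟨ cong (ℤ._+ a) s₁≡s₂+d ⟩
    s₂ ℤ.+ + d ℤ.+ a      ≡⟨ ℤP.+-assoc s₂ (+ d) a ⟩
    s₂ ℤ.+ (+ d ℤ.+ a)    ≡⟨ cong (λ x → s₂ ℤ.+ x) (ℤP.+-comm (+ d) a) ⟩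
    s₂ ℤ.+ (a ℤ.+ + d)    ∎

differences-0146 : ∀ d → 0 < d → d ≤ 6 → IsDifference (+ 0 ∷ + 1 ∷ + 4 ∷ + 6 ∷ []) (+ d)
differences-0146 1 _ _ = + 1 , + 0 , there (here refl) , here refl , refl
differences-0146 2 _ _ = + 6 , + 4 , there (there (there (here refl))) , there (there (here refl)) , refl
differences-0146 3 _ _ = + 4 , + 1 , there (there (here refl)) , there (here refl) , refl
differences-0146 4 _ _ = + 4 , + 0 , there (there (here refl)) , here refl , refl
differences-0146 5 _ _ = + 6 , + 1 , there (there (there (here refl))) , there (here refl) , refl
differences-0146 6 _ _ = + 6 , + 0 , there (there (there (here refl))) , here refl , refl
differences-0146 (suc (suc (suc (suc (suc (suc (suc _))))))) _ (s≤s (s≤s (s≤s (s≤s (s≤s (s≤s ()))))))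

module _ {g : ℕ} {A : Subset} (separated : Separated g A) (n : ℕ) where

  private
    count : ℕ → ℕ
    count = countFrom A n

  position-+ : ∀ i d → + (i ℕ.+ d) ℤ.- + n ≡ (+ i ℤ.- + n) ℤ.+ + d
  position-+ i d = trans (cong (ℤ._- + n) (ℤP.pos-+ i d)) (shift (+ i) (+ d) (+ n))
    where
    shift : ∀ x y z → x ℤ.+ y ℤ.- z ≡ x ℤ.- z ℤ.+ y
    shift = solve-∀

  separated-positions : ∀ i j → i < j → j ≤ i ℕ.+ g →
                        A (+ i ℤ.- + n) ≡ true → A (+ j ℤ.- + n) ≡ true → ⊥
  separated-positions i j i<j j≤i+g i∈A j∈A =
    separated (+ i ℤ.- + n) (j ℕ.∸ i) (ℕP.m<n⇒0<n∸m i<j) (ℕP.m≤n+o⇒m∸n≤o j i j≤i+g) i∈A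
      (subst (λ x → A x ≡ true) (position-+ i (j ℕ.∸ i))
        (subst (λ k → A (+ k ℤ.- + n) ≡ true) (sym (ℕP.m+[n∸m]≡n (ℕP.<⇒≤ i<j))) j∈A))

  count-gap : ∀ p L → (∀ j → j < L → A (+ (j ℕ.+ p) ℤ.- + n) ≡ false) →
              count (L ℕ.+ p) ≡ count p
  count-gap p zero gap = refl
  count-gap p (suc L) gap rewrite gap L ℕP.≤-refl =
    count-gap p L (λ j j<L → gap j (ℕP.m<n⇒m<1+n j<L))

  count-window : ∀ p L → L ≤ suc g → count (L ℕ.+ p) ≤ suc (count p)
  count-window p zero _ = ℕP.n≤1+n (count p)
  count-window p (suc L) (s≤s L≤g) with A (+ (L ℕ.+ p) ℤ.- + n) in top∈A
  ... | false = count-window p L (ℕP.m≤n⇒m≤1+n L≤g)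
  ... | true  = s≤s (ℕP.≤-reflexive (count-gap p L below-top))
    where
    below-top : ∀ j → j < L → A (+ (j ℕ.+ p) ℤ.- + n) ≡ false
    below-top j j<L with A (+ (j ℕ.+ p) ℤ.- + n) in j+p∈A
    ... | false = refl
    ... | true  = ⊥-elim (separated-positions (j ℕ.+ p) (L ℕ.+ p)
                            (ℕP.+-monoˡ-< p j<L) within j+p∈A top∈A)
      where
      open ℕP.≤-Reasoning
      within : L ℕ.+ p ≤ j ℕ.+ p ℕ.+ g
      within = begin
        L ℕ.+ p          ≤⟨ ℕP.+-monoˡ-≤ p L≤g ⟩
        g ℕ.+ p          ≡⟨ ℕP.+-comm g p ⟩
        p ℕ.+ g          ≤⟨ ℕP.+-monoˡ-≤ g (ℕP.m≤n+m p j) ⟩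
        j ℕ.+ p ℕ.+ g    ∎

  count-bound : ∀ m → count m ℕ.* suc g ≤ m ℕ.+ g
  count-bound = <-rec _ bound
    where
    open ℕP.≤-Reasoning
    bound : ∀ m → (∀ {p} → p < m → count p ℕ.* suc g ≤ p ℕ.+ g) →
            count m ℕ.* suc g ≤ m ℕ.+ g
    bound zero _ = z≤n
    bound (suc m) rec with suc g ℕP.≤? suc m
    ... | no K≰m = begin
      count (suc m) ℕ.* suc g      ≤⟨ ℕP.*-monoˡ-≤ (suc g) at-most-one ⟩
      1 ℕ.* suc g                  ≡⟨ ℕP.*-identityˡ (suc g) ⟩
      suc g                        ≤⟨ s≤s (ℕP.m≤n+m g m) ⟩
      suc m ℕ.+ g                  ∎
      where
      at-most-one : count (suc m) ≤ 1
      at-most-one = subst (λ k → count k ≤ 1) (ℕP.+-identityʳ (suc m))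
                      (count-window 0 (suc m) (ℕP.<⇒≤ (ℕP.≰⇒> K≰m)))
    ... | yes K≤m with ℕP.m≤n⇒∃[o]m+o≡n K≤m
    ... | p , refl = begin
      count (suc g ℕ.+ p) ℕ.* suc g    ≤⟨ ℕP.*-monoˡ-≤ (suc g) (count-window p (suc g) ℕP.≤-refl) ⟩
      suc g ℕ.+ count p ℕ.* suc g      ≤⟨ ℕP.+-monoʳ-≤ (suc g) (rec (ℕP.m<n+m p (s≤s z≤n))) ⟩
      suc g ℕ.+ (p ℕ.+ g)              ≡⟨ ℕP.+-assoc (suc g) p g ⟨
      suc g ℕ.+ p ℕ.+ g                ∎

cross-bound : ∀ c m g d p → c ℕ.* suc g ≤ suc m ℕ.+ g → suc d ≤ suc m →
              c ℕ.* (suc g ℕ.* suc d) ≤ (suc d ℕ.+ suc p ℕ.* suc g) ℕ.* suc m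
cross-bound c m g d p cK≤M+g D≤M = begin
  c ℕ.* (K ℕ.* D)          ≡⟨ ℕP.*-assoc c K D ⟨
  c ℕ.* K ℕ.* D            ≤⟨ ℕP.*-monoˡ-≤ D cK≤M+g ⟩
  (M ℕ.+ g) ℕ.* D          ≡⟨ ℕP.*-distribʳ-+ D M g ⟩
  M ℕ.* D ℕ.+ g ℕ.* D      ≤⟨ ℕP.+-monoʳ-≤ (M ℕ.* D) (ℕP.*-mono-≤ (ℕP.n≤1+n g) D≤M) ⟩
  M ℕ.* D ℕ.+ K ℕ.* M      ≤⟨ ℕP.+-monoʳ-≤ (M ℕ.* D) (ℕP.*-monoˡ-≤ M (ℕP.m≤n*m K P)) ⟩
  M ℕ.* D ℕ.+ P ℕ.* K ℕ.* M  ≡⟨ cong (ℕ._+ P ℕ.* K ℕ.* M) (ℕP.*-comm M D) ⟩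
  D ℕ.* M ℕ.+ P ℕ.* K ℕ.* M  ≡⟨ ℕP.*-distribʳ-+ M D (P ℕ.* K) ⟨
  (D ℕ.+ P ℕ.* K) ℕ.* M    ∎
  where
  open ℕP.≤-Reasoning
  K = suc g
  D = suc d
  M = suc m
  P = suc p

unnormalised-ratio-bound : ∀ c m g d p → c ℕ.* suc g ≤ suc m ℕ.+ g → suc d ≤ suc m →
                           ℚᵘ.mkℚᵘ (+ c) m ℚᵘ.≤ ℚᵘ.mkℚᵘ (+ 1) g ℚᵘ.+ ℚᵘ.mkℚᵘ (+ suc p) d
unnormalised-ratio-bound c m g d p cK≤M+g D≤M =
  ℚᵘ.*≤* (subst₂ ℤ._≤_ (ℤP.pos-* c (suc g ℕ.* suc d)) numerator
                        (ℤ.+≤+ (cross-bound c m g d p cK≤M+g D≤M)))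
  where
  numerator : + ((suc d ℕ.+ suc p ℕ.* suc g) ℕ.* suc m) ≡
              ℚᵘ.↥ (ℚᵘ.mkℚᵘ (+ 1) g ℚᵘ.+ ℚᵘ.mkℚᵘ (+ suc p) d) ℤ.* + suc m
  numerator = trans (ℤP.pos-* (suc d ℕ.+ suc p ℕ.* suc g) (suc m))
    (cong (λ k → + (k ℕ.+ suc p ℕ.* suc g) ℤ.* + suc m) (sym (ℕP.*-identityˡ (suc d))))

fromℚᵘ-≤ : ∀ x q → x ℚᵘ.≤ ℚ.toℚᵘ q → ℚ.fromℚᵘ x ℚ.≤ q
fromℚᵘ-≤ x q x≤q = ℚP.toℚᵘ-cancel-≤ (ℚᵘP.≤-respˡ-≃ (ℚᵘP.≃-sym (ℚP.toℚᵘ-fromℚᵘ x)) x≤q)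

-- With ε = P/D and M = 2n + 1 the count bound gives c/M ≤ 1/(g+1) + g/((g+1)M) < 1/(g+1) + 1/M,
-- and 1/M ≤ 1/D ≤ ε once n ≥ D.
separated⇒upperDensity≤ : ∀ {g A} → Separated g A → UpperDensity≤ A (+ 1 / suc g)
separated⇒upperDensity≤ _ (ℚ.mkℚ (+ zero) _ _) ()
separated⇒upperDensity≤ _ (ℚ.mkℚ ℤ.-[1+ _ ] _ _) ()
separated⇒upperDensity≤ {g} {A} separated ε@(ℚ.mkℚ ℤ.+[1+ p ] d _) _ = suc d , λ n d<n →
  fromℚᵘ-≤ _ (+ 1 / suc g ℚ.+ ε)
    (ℚᵘP.≤-respʳ-≃ (ℚᵘP.≃-sym toℚᵘ-bound)
      (unnormalised-ratio-bound (countIn A n) (n ℕ.+ n) g d p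
        (count-bound separated n (suc (n ℕ.+ n)))
        (ℕP.m≤n⇒m≤1+n (ℕP.m≤n⇒m≤n+o n d<n))))
  where
  toℚᵘ-bound : ℚ.toℚᵘ (+ 1 / suc g ℚ.+ ε) ℚᵘ.≃ ℚᵘ.mkℚᵘ (+ 1) g ℚᵘ.+ ℚᵘ.mkℚᵘ (+ suc p) d
  toℚᵘ-bound = ℚᵘP.≃-trans (ℚP.toℚᵘ-homo-+ (+ 1 / suc g) ε)
                 (ℚᵘP.+-congˡ (ℚ.toℚᵘ ε) (ℚP.toℚᵘ-fromℚᵘ (ℚᵘ.mkℚᵘ (+ 1) g)))

corollary2p2 : PackingDensity≤ (+ 0 ∷ + 1 ∷ + 4 ∷ + 6 ∷ []) (+ 1 / 7)
corollary2p2 A packing =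
  separated⇒upperDensity≤ (packing⇒separated _ A 6 differences-0146 packing)
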